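{- Let $r\ge2$ be an integer and $G$ an $r$-large complete bipartite graph. Then $\sigma(G,2,r)\ge\left\lceil\frac{\lfloor 7r/2\rfloor-3}{5}\right\rceil$.
   Context: A complete bipartite graph is $r$-large if each of its two parts has at least $2r$ vertices. The game $\mathrm{RS}(G,m,r,s)$ is played on a finite graph $G$ by $r$ revolutionaries and $s$ spies. First each revolutionary occupies a vertex, then each spy occupies a vertex (several players may share a vertex). In each subsequent round, each revolutionary may move to an adjacent vertex or stay put, and then each spy may move to an adjacent vertex or stay put; all positions are known to all players. The revolutionaries win if at the end of some round (the initial placement counts as a round) some vertex holds at least $m$ revolutionaries and no spy; the spies win if this never happens. $\sigma(G,m,r)$ denotes the minimum $s$ such that the spies have a winning strategy in $\mathrm{RS}(G,m,r,s)$. Standing assumption: $|V(G)|\ge r-m+1\ge\lfloor r/m\rfloor\ge1$. -}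

module Defs where

open import Data.Nat using (ℕ; zero; suc; _+_; _*_; _∸_; _≤_; _<_)
open import Data.Nat.DivMod using (_/_)
open import Data.Fin using (Fin)
open import Data.Sum using (_⊎_; inj₁; inj₂)
open import Data.Product using (Σ; ∃; ∃-syntax; _×_; _,_; proj₁; proj₂)
open import Data.List using (List; []; _∷_)
open import Data.Unit using (⊤)
open import Data.Empty using (⊥)
open import Relation.Nullary using (¬_)
open import Relation.Binary.PropositionalEquality using (_≡_)
open import Function.Definitions using (Injective)

record Graph : Set₁ where
  field
    V   : Set
    Adj : V → V → Set

open Graph public

KBip-adj : {a b : ℕ} → Fin a ⊎ Fin b → Fin a ⊎ Fin b → Set
KBip-adj (inj₁ _) (inj₁ _) = ⊥
KBip-adj (inj₁ _) (inj₂ _) = ⊤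
KBip-adj (inj₂ _) (inj₁ _) = ⊤
KBip-adj (inj₂ _) (inj₂ _) = ⊥

KBip : ℕ → ℕ → Graph
KBip a b = record { V = Fin a ⊎ Fin b ; Adj = KBip-adj {a} {b} }

module Game (G : Graph) (m r s : ℕ) where

  RevPos : Set
  RevPos = Fin r → V G

  SpyPos : Set
  SpyPos = Fin s → V G

  Config : Set
  Config = RevPos × SpyPos

  Step : {k : ℕ} → (Fin k → V G) → (Fin k → V G) → Set
  Step p p' = ∀ i → (p' i ≡ p i) ⊎ Adj G (p i) (p' i)

  RevWinAt : Config → Set
  RevWinAt (R , S) =
    ∃[ v ] (Σ (Fin m → Fin r) λ f → Injective _≡_ _≡_ f × (∀ k → R (f k) ≡ v))
           × (∀ j → ¬ (S j ≡ v))

  -- Strategies may depend on the whole history (list of previous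
  -- end-of-round configurations, most recent first) and the current configuration.
  record RevStrategy : Set where
    field
      init : RevPos
      move : List Config → (c : Config) → Σ RevPos (Step (proj₁ c))

  record SpyStrategy : Set where
    field
      init : RevPos → SpyPos
      move : List Config → (c : Config) → RevPos → Σ SpyPos (Step (proj₂ c))

  -- (previous history , configuration at the end of round n)
  play : RevStrategy → SpyStrategy → ℕ → List Config × Config
  play ρ σ zero = [] , (RevStrategy.init ρ , SpyStrategy.init σ (RevStrategy.init ρ))
  play ρ σ (suc n) with play ρ σ n
  ... | h , c =
    let R' = proj₁ (RevStrategy.move ρ h c)
        S' = proj₁ (SpyStrategy.move σ h c R')
    in (c ∷ h) , (R' , S')

  SpiesWin : Set
  SpiesWin = Σ SpyStrategy λ σ → ∀ (ρ : RevStrategy) (n : ℕ) → ¬ RevWinAt (proj₂ (play ρ σ n))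

SpiesWinRS : Graph → ℕ → ℕ → ℕ → Set
SpiesWinRS G m r s = Game.SpiesWin G m r s

σ≥ : Graph → ℕ → ℕ → ℕ → Set
σ≥ G m r k = ∀ s → s < k → ¬ SpiesWinRS G m r s

-- ceiling division ⌈x / d⌉ for d ≥ 1
⌈_/_⌉ : ℕ → (d : ℕ) → ℕ
⌈ x / d ⌉ = (x + (d ∸ 1)) / suc (d ∸ 1)

module Submission where

-- Theorem 7.2: for r ≥ 2 and a, b ≥ 2r, fewer than ⌈(⌊7r/2⌋ − 3)/5⌉ spies cannot win
-- RS(K_{a,b}, 2, r, s).  (The argument does not need r ≥ 2.)
--
-- Against a winning spy strategy with s ≤ r spies the revolutionaries play two
-- rounds and count.  In round 0 they occupy r distinct vertices of X.  Meetings are the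
-- threat: revolutionaries on one side can walk onto unguarded partners or pair up on free
-- vertices of the other side, every such meeting point must then receive its own spy, and
-- that spy must come from the opposite side (the threat lemma `AtPosition.threat-at`).
-- Threatening Y in round 1 forces about r/2 spies into X.  The revolutionaries then move a
-- set K of exactly as many of them to free vertices of Y, K containing every guarded one.
-- In round 2 they threaten both sides; classifying the spies by their sides in rounds 0 and 1
-- (A, B, C, E) and bounding the guards of round-1 positions by the spies that crossed gives
-- linear inequalities which force 7r ≤ 10s + 7 (`seven-r-bound`).  The bound in the theorem
-- says exactly that 10s + 7 < 7r.

open import Defs
open import Data.Nat using (ℕ; zero; suc; _+_; _*_; _∸_; _≤_; _<_; z≤n; s≤s; _<ᵇ_; _≡ᵇ_; _≤?_)
open import Data.Nat.DivMod using (_/_; m/n*n≤m)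
open import Data.Nat.Properties hiding (_≟_; suc-injective)
open import Data.Nat.Tactic.RingSolver using (solve)
open import Data.Bool using (Bool; true; false; not; _∧_; _∨_; T; if_then_else_)
open import Data.Bool.Properties using (∧-identityʳ; ∧-comm; not-¬; not-involutive; T-∧; T-∨; T-≡)
open import Data.Fin using (Fin; zero; suc; toℕ; inject≤)
open import Data.Fin.Properties using (_≟_; any?; toℕ<n; toℕ-injective; suc-injective; inject≤-injective)
open import Data.Sum using (_⊎_; inj₁; inj₂)
open import Data.Sum.Properties using (≡-dec; inj₁-injective; inj₂-injective)
open import Data.Product using (Σ; ∃-syntax; _×_; _,_; proj₁; proj₂)
open import Data.Empty using (⊥-elim)
open import Data.List using (List; []; _∷_; length; map; _++_; tabulate)
open import Data.List.Properties using (length-map; length-tabulate)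
open import Data.List.Membership.Propositional.Properties using (∈-map⁻)
import Data.List.Relation.Unary.All as All
import Data.List.Relation.Unary.All.Properties as AllP
import Data.List.Relation.Unary.Unique.Propositional as Unique
import Data.List.Relation.Unary.Unique.Propositional.Properties as UniqueP
import Data.List.Relation.Binary.Sublist.Propositional as Sublist
open import Data.List.Relation.Binary.Sublist.Propositional.Properties using (All-resp-⊆)
open import Data.Vec.Functional using (updateAt)
open import Data.Vec.Functional.Properties using (updateAt-updates; updateAt-minimal)
open import Function using (_∘_; const; Equivalence)
open import Function.Definitions using (Injective)
open import Relation.Nullary using (¬_; does; yes; no)
open import Relation.Nullary.Decidable using (dec-false)
open import Relation.Binary.PropositionalEquality
open import Algebra.Properties.CommutativeSemigroup +-commutativeSemigroup using (interchange; x∙yz≈y∙xz)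

-- `Threat mov part M` says M ≥ min(mov, ⌊(mov + part)/2⌋): this many distinct meetings can
-- be staged in one round by mov revolutionaries walking onto the side where part unguarded
-- revolutionaries stand (each meeting pairs a walker with a stander or with another walker).
Threat : ℕ → ℕ → ℕ → Set
Threat mov part M = mov ≤ M ⊎ mov + part ≤ 2 * M + 1

threat-mono : ∀ {mov part M N} → Threat mov part M → M ≤ N → Threat mov part N
threat-mono (inj₁ mov≤M) M≤N = inj₁ (≤-trans mov≤M M≤N)
threat-mono (inj₂ le)    M≤N = inj₂ (≤-trans le (+-monoˡ-≤ 1 (*-monoʳ-≤ 2 M≤N)))

threat-pair : ∀ {mov part M} → Threat mov part M → Threat (suc mov) (suc part) (suc M)
threat-pair (inj₁ mov≤M) = inj₁ (s≤s mov≤M)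
threat-pair {mov} {part} {M} (inj₂ le) = inj₂ (begin
  suc mov + suc part    ≡⟨ solve (mov ∷ part ∷ []) ⟩
  2 + (mov + part)      ≤⟨ +-monoʳ-≤ 2 le ⟩
  2 + (2 * M + 1)       ≡⟨ solve (M ∷ []) ⟩
  2 * suc M + 1         ∎)
  where open ≤-Reasoning

threat-≤ : ∀ {mov part M} → Threat mov part M → mov ≤ 2 * M + 1
threat-≤ {mov} {part} {M} (inj₁ mov≤M) = ≤-trans mov≤M (≤-trans (m≤m+n M (M + 0)) (m≤m+n (2 * M) 1))
threat-≤ {mov} {part} {M} (inj₂ le)    = ≤-trans (m≤m+n mov part) le

threat-walkers : ∀ {mov M} → Threat mov 0 M → Threat (2 + mov) 0 (suc M)
threat-walkers {mov} {M} t = inj₂ (begin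
  2 + mov + 0       ≡⟨ +-identityʳ (2 + mov) ⟩
  2 + mov           ≤⟨ +-monoʳ-≤ 2 (threat-≤ t) ⟩
  2 + (2 * M + 1)   ≡⟨ solve (M ∷ []) ⟩
  2 * suc M + 1     ∎)
  where open ≤-Reasoning

-- A, B, C, E count the spies by their sides in
-- rounds 0 and 1 (X→X, X→Y, Y→X, Y→Y).  In round 1, k = A + B revolutionaries cross to Y and
-- m stay in X.  The inputs are the threats available in rounds 1 and 2; in round 2 the
-- revolutionaries of each side split into unguarded (pX, pY) and guarded (gX, gY) ones, and
-- the guard of a round-1 position has crossed into its side (gX ≤ C, gY ≤ B).
seven-r-bound : ∀ {r A B C E k m pR pX gX pY gY} →
  Threat r pR (A + B) → k ≡ A + B → k + m ≡ r →
  Threat k pX (B + E) → k + pX + gX ≡ r → gX ≤ C →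
  Threat m pY (A + C) → m + pY + gY ≡ r → gY ≤ B →
  7 * r ≤ 10 * (A + B + C + E) + 7
seven-r-bound {r} {A} {B} {C} {E} {k} {m} {pR} {pX} {gX} {pY} {gY}
  round1 k≡A+B k+m≡r threatX rX gX≤C threatY rY gY≤B = combine (boundX threatX)
  where
  open ≤-Reasoning

  bound₁ : r ≤ 2 * (A + B) + 1
  bound₁ = threat-≤ round1

  boundY : Threat m pY (A + C) → r ≤ 2 * A + B + 2 * C + 1
  boundY (inj₁ m≤A+C) = begin
    r                         ≡⟨ k+m≡r ⟨
    k + m                     ≤⟨ +-mono-≤ (≤-reflexive k≡A+B) m≤A+C ⟩
    (A + B) + (A + C)         ≤⟨ m≤m+n _ (C + 1) ⟩
    (A + B) + (A + C) + (C + 1) ≡⟨ solve (A ∷ B ∷ C ∷ []) ⟩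
    2 * A + B + 2 * C + 1     ∎
  boundY (inj₂ m+pY≤) = begin
    r                         ≡⟨ rY ⟨
    m + pY + gY               ≤⟨ +-mono-≤ m+pY≤ gY≤B ⟩
    2 * (A + C) + 1 + B       ≡⟨ solve (A ∷ B ∷ C ∷ []) ⟩
    2 * A + B + 2 * C + 1     ∎

  boundX : Threat k pX (B + E) → A ≤ E ⊎ r ≤ 2 * B + 2 * E + C + 1
  boundX (inj₁ k≤B+E) = inj₁ (+-cancelʳ-≤ B A E (begin
    A + B                     ≡⟨ k≡A+B ⟨
    k                         ≤⟨ k≤B+E ⟩
    B + E                     ≡⟨ +-comm B E ⟩
    E + B                     ∎))
  boundX (inj₂ k+pX≤) = inj₂ (begin
    r                         ≡⟨ rX ⟨
    k + pX + gX               ≤⟨ +-mono-≤ k+pX≤ gX≤C ⟩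
    2 * (B + E) + 1 + C       ≡⟨ solve (B ∷ C ∷ E ∷ []) ⟩
    2 * B + 2 * E + C + 1     ∎)

  combine : A ≤ E ⊎ r ≤ 2 * B + 2 * E + C + 1 → 7 * r ≤ 10 * (A + B + C + E) + 7
  combine (inj₁ A≤E) = begin
    7 * r                                             ≡⟨ solve (r ∷ []) ⟩
    2 * r + 5 * r                                     ≤⟨ +-mono-≤ (*-monoʳ-≤ 2 bound₁) (*-monoʳ-≤ 5 (boundY threatY)) ⟩
    2 * (2 * (A + B) + 1) + 5 * (2 * A + B + 2 * C + 1) ≡⟨ solve (A ∷ B ∷ C ∷ []) ⟩
    10 * A + 9 * B + 10 * C + 7 + 4 * A               ≤⟨ +-monoʳ-≤ (10 * A + 9 * B + 10 * C + 7) (*-monoʳ-≤ 4 A≤E) ⟩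
    10 * A + 9 * B + 10 * C + 7 + 4 * E               ≤⟨ m≤m+n _ (B + 6 * E) ⟩
    10 * A + 9 * B + 10 * C + 7 + 4 * E + (B + 6 * E) ≡⟨ solve (A ∷ B ∷ C ∷ E ∷ []) ⟩
    10 * (A + B + C + E) + 7                          ∎
  combine (inj₂ r≤) = begin
    7 * r                                             ≡⟨ solve (r ∷ []) ⟩
    r + 4 * r + 2 * r
      ≤⟨ +-mono-≤ (+-mono-≤ bound₁ (*-monoʳ-≤ 4 (boundY threatY))) (*-monoʳ-≤ 2 r≤) ⟩
    2 * (A + B) + 1 + 4 * (2 * A + B + 2 * C + 1) + 2 * (2 * B + 2 * E + C + 1)
                                                      ≡⟨ solve (A ∷ B ∷ C ∷ E ∷ []) ⟩
    10 * (A + B + C) + 4 * E + 7                      ≤⟨ m≤m+n _ (6 * E) ⟩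
    10 * (A + B + C) + 4 * E + 7 + 6 * E              ≡⟨ solve (A ∷ B ∷ C ∷ E ∷ []) ⟩
    10 * (A + B + C + E) + 7                          ∎

below-bound : ∀ r s → s < ⌈ ((7 * r) / 2 ∸ 3) / 5 ⌉ → 10 * s + 7 < 7 * r
below-bound r s s<⌈⌉ = begin-strict
  10 * s + 7        <⟨ +-monoʳ-< (10 * s) (n<1+n 7) ⟩
  10 * s + 8        ≡⟨ solve (s ∷ []) ⟩
  (5 * s + 4) * 2   ≤⟨ *-monoˡ-≤ 2 5s+4≤y ⟩
  y * 2             ≤⟨ m/n*n≤m (7 * r) 2 ⟩
  7 * r             ∎
  where
  open ≤-Reasoning
  y : ℕ
  y = (7 * r) / 2
  -- ⌈x/5⌉ unfolds to (x + 4)/5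
  5s+5≤x+4 : 5 * s + 1 + 4 ≤ y ∸ 3 + 4
  5s+5≤x+4 = begin
    5 * s + 1 + 4              ≡⟨ solve (s ∷ []) ⟩
    suc s * 5                  ≤⟨ *-monoˡ-≤ 5 s<⌈⌉ ⟩
    (y ∸ 3 + 4) / 5 * 5        ≤⟨ m/n*n≤m (y ∸ 3 + 4) 5 ⟩
    y ∸ 3 + 4                  ∎
  5s+1≤x : 5 * s + 1 ≤ y ∸ 3
  5s+1≤x = +-cancelʳ-≤ 4 _ _ 5s+5≤x+4
  3≤y : 3 ≤ y
  3≤y = <⇒≤ (m∸n≢0⇒n<m (λ x≡0 → n≮0 (≤-trans (m≤n+m 1 (5 * s)) (subst (5 * s + 1 ≤_) x≡0 5s+1≤x))))
  5s+4≤y : 5 * s + 4 ≤ y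
  5s+4≤y = begin
    5 * s + 4        ≡⟨ solve (s ∷ []) ⟩
    5 * s + 1 + 3    ≤⟨ m≤o∸n⇒m+n≤o (5 * s + 1) 3≤y 5s+1≤x ⟩
    y                ∎

-- The list predicates are opened only now: the ring solver calls above write their
-- variable lists with the (then unambiguous) list constructors.
open All using (All; []; _∷_)
open Unique using (Unique; []; _∷_)
open Sublist using (_⊆_; []; _∷_; _∷ʳ_; minimum)

ind : Bool → ℕ
ind true  = 1
ind false = 0

count : ∀ {n} → (Fin n → Bool) → ℕ
count {zero}  P = 0
count {suc n} P = ind (P zero) + count (P ∘ suc)

count-ext : ∀ {n} {P Q : Fin n → Bool} → (∀ i → P i ≡ Q i) → count P ≡ count Q
count-ext {zero}  P≗Q = refl
count-ext {suc n} P≗Q = cong₂ _+_ (cong ind (P≗Q zero)) (count-ext (P≗Q ∘ suc))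

count-all : ∀ n → count {n} (λ _ → true) ≡ n
count-all zero    = refl
count-all (suc n) = cong suc (count-all n)

count-split : ∀ {n} (P Q : Fin n → Bool) →
  count (λ i → P i ∧ Q i) + count (λ i → P i ∧ not (Q i)) ≡ count P
count-split {zero}  P Q = refl
count-split {suc n} P Q =
  trans (interchange (ind (P zero ∧ Q zero)) _ (ind (P zero ∧ not (Q zero))) _)
        (cong₂ _+_ (ind-split (P zero) (Q zero)) (count-split (P ∘ suc) (Q ∘ suc)))
  where
  ind-split : ∀ p q → ind (p ∧ q) + ind (p ∧ not q) ≡ ind p
  ind-split true  true  = refl
  ind-split true  false = refl
  ind-split false q     = refl

count-complement : ∀ {n} (P : Fin n → Bool) → count P + count (not ∘ P) ≡ n
count-complement {n} P = trans (count-split (λ _ → true) P) (count-all n)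

count-∨ : ∀ {n} (P Q : Fin n → Bool) → count (λ i → P i ∨ Q i) ≤ count P + count Q
count-∨ {zero}  P Q = z≤n
count-∨ {suc n} P Q = begin
  ind (P zero ∨ Q zero) + count (λ i → P (suc i) ∨ Q (suc i))
    ≤⟨ +-mono-≤ (ind-∨ (P zero) (Q zero)) (count-∨ (P ∘ suc) (Q ∘ suc)) ⟩
  (ind (P zero) + ind (Q zero)) + (count (P ∘ suc) + count (Q ∘ suc))
    ≡⟨ interchange (ind (P zero)) _ _ _ ⟩
  count P + count Q ∎
  where
  open ≤-Reasoning
  ind-∨ : ∀ p q → ind (p ∨ q) ≤ ind p + ind q
  ind-∨ true  q     = s≤s z≤n
  ind-∨ false q     = ≤-refl

count-mono : ∀ {n} {P Q : Fin n → Bool} → (∀ i → T (P i) → T (Q i)) → count P ≤ count Q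
count-mono {zero}          P⊆Q = z≤n
count-mono {suc n} {P} {Q} P⊆Q = +-mono-≤ (ind-mono (P zero) (Q zero) (P⊆Q zero)) (count-mono (P⊆Q ∘ suc))
  where
  ind-mono : ∀ p q → (T p → T q) → ind p ≤ ind q
  ind-mono true  true  _ = ≤-refl
  ind-mono true  false f = ⊥-elim (f _)
  ind-mono false q     _ = z≤n

count-remove : ∀ {n} (P : Fin n → Bool) k → T (P k) →
  count P ≡ suc (count (λ i → P i ∧ not (does (i ≟ k))))
count-remove {suc n} P zero Pk with P zero
... | true = cong suc (count-ext (λ i → sym (∧-identityʳ (P (suc i)))))
count-remove {suc n} P (suc k) Pk = begin
  ind (P zero) + count (P ∘ suc)
    ≡⟨ cong₂ _+_ (cong ind (sym (∧-identityʳ (P zero)))) (count-remove (P ∘ suc) k Pk) ⟩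
  ind (P zero ∧ true) + suc (count (λ i → P (suc i) ∧ not (does (i ≟ k))))
    ≡⟨ +-suc _ _ ⟩
  suc (count (λ i → P i ∧ not (does (i ≟ suc k)))) ∎
  where open ≡-Reasoning

enumerate : ∀ {n} (P : Fin n → Bool) → Fin (count P) → Fin n
enumerate {suc n} P q with P zero
enumerate {suc n} P zero    | true  = zero
enumerate {suc n} P (suc q) | true  = suc (enumerate (P ∘ suc) q)
enumerate {suc n} P q       | false = suc (enumerate (P ∘ suc) q)

enumerate-sound : ∀ {n} (P : Fin n → Bool) q → T (P (enumerate P q))
enumerate-sound {suc n} P q with P zero in eq
enumerate-sound {suc n} P zero    | true  = subst T (sym eq) _
enumerate-sound {suc n} P (suc q) | true  = enumerate-sound (P ∘ suc) q
enumerate-sound {suc n} P q       | false = enumerate-sound (P ∘ suc) q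

enumerate-injective : ∀ {n} (P : Fin n → Bool) q q′ → enumerate P q ≡ enumerate P q′ → q ≡ q′
enumerate-injective {suc n} P q q′ eq with P zero
enumerate-injective {suc n} P zero    zero     eq | true  = refl
enumerate-injective {suc n} P (suc q) (suc q′) eq | true  =
  cong suc (enumerate-injective (P ∘ suc) q q′ (suc-injective eq))
enumerate-injective {suc n} P q       q′       eq | false =
  enumerate-injective (P ∘ suc) q q′ (suc-injective eq)

members : ∀ {n} → (Fin n → Bool) → List (Fin n)
members P = tabulate (enumerate P)

members-length : ∀ {n} (P : Fin n → Bool) → length (members P) ≡ count P
members-length P = length-tabulate (enumerate P)

members-unique : ∀ {n} (P : Fin n → Bool) → Unique (members P)
members-unique P = UniqueP.tabulate⁺ (enumerate-injective P _ _)

members-sound : ∀ {n} (P : Fin n → Bool) → All (T ∘ P) (members P)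
members-sound P = AllP.tabulate⁺ (enumerate-sound P)

length≤count : ∀ {X : Set} {m} (Q : X → Set) (P : Fin m → Bool) (h : ∀ x → Q x → Fin m) →
  (∀ x q → T (P (h x q))) → (∀ x y q q′ → h x q ≡ h y q′ → x ≡ y) →
  ∀ xs → Unique xs → All Q xs → length xs ≤ count P
length≤count Q P h hP h-inj []       _          _        = z≤n
length≤count Q P h hP h-inj (x ∷ xs) (x∉xs ∷ u) (q ∷ qs) = begin
  suc (length xs) ≤⟨ s≤s (length≤count Q′ P′ h′ hP′ h′-inj xs u (All.zip (qs , x∉xs))) ⟩
  suc (count P′)  ≡⟨ count-remove P (h x q) (hP x q) ⟨
  count P         ∎
  where
  open ≤-Reasoning
  Q′ : _ → Set
  Q′ y = Q y × x ≢ y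
  P′ : Fin _ → Bool
  P′ i = P i ∧ not (does (i ≟ h x q))
  h′ : ∀ y → Q′ y → Fin _
  h′ y (q′ , _) = h y q′
  hP′ : ∀ y q′ → T (P′ (h′ y q′))
  hP′ y (q′ , x≢y) = Equivalence.from T-∧ (hP y q′ , subst (T ∘ not) (sym (dec-false (h y q′ ≟ h x q) hy≢hx)) _)
    where
    hy≢hx : h y q′ ≢ h x q
    hy≢hx e = x≢y (h-inj x y q q′ (sym e))
  h′-inj : ∀ y z q′ q″ → h′ y q′ ≡ h′ z q″ → y ≡ z
  h′-inj y z (q′ , _) (q″ , _) = h-inj y z q′ q″

count≤count : ∀ {n m} (A : Fin n → Bool) (P : Fin m → Bool) (h : ∀ i → T (A i) → Fin m) →
  (∀ i a → T (P (h i a))) → (∀ i j a b → h i a ≡ h j b → i ≡ j) → count A ≤ count P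
count≤count A P h hP h-inj = subst (_≤ count P) (members-length A)
  (length≤count (T ∘ A) P h hP h-inj (members A) (members-unique A) (members-sound A))

T-∨-introˡ : ∀ {x} y → T x → T (x ∨ y)
T-∨-introˡ {true} y _ = _

T-∨-introʳ : ∀ x {y} → T y → T (x ∨ y)
T-∨-introʳ true  _  = _
T-∨-introʳ false Ty = Ty

discrete-ivt : (f : ℕ → ℕ) {k : ℕ} → f 0 ≤ k → (∀ t → f (suc t) ≤ suc (f t)) →
  ∀ n → k ≤ f n → ∃[ t ] f t ≡ k
discrete-ivt f f0≤k grow zero    k≤fn = 0 , ≤-antisym f0≤k k≤fn
discrete-ivt f {k} f0≤k grow (suc n) k≤fn with k ≤? f n
... | yes k≤fn′ = discrete-ivt f f0≤k grow n k≤fn′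
... | no  k≰fn′ = suc n , ≤-antisym (≤-trans (grow n) (≰⇒> k≰fn′)) k≤fn

-- Any G ⊆ Fin n can be enlarged to a set K ⊇ G of any size between |G| and n:
-- take K = G ∪ {i : i < t} for a suitable threshold t.
enlarge : ∀ {n} (G : Fin n → Bool) k → count G ≤ k → k ≤ n →
  Σ (Fin n → Bool) λ K → (∀ i → T (G i) → T (K i)) × count K ≡ k
enlarge {n} G k G≤k k≤n = segment t , (λ i → T-∨-introʳ (toℕ i <ᵇ t)) , size-t≡k
  where
  segment : ℕ → Fin n → Bool
  segment t i = (toℕ i <ᵇ t) ∨ G i

  size : ℕ → ℕ
  size t = count (segment t)

  size-n : size n ≡ n
  size-n = trans (count-ext (λ i → cong (_∨ G i) (Equivalence.to T-≡ (<⇒<ᵇ (toℕ<n i))))) (count-all n)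

  point : ℕ → Fin n → Bool
  point t i = toℕ i ≡ᵇ t

  at-most-one : ∀ t → count (point t) ≤ 1
  at-most-one t = ≤-trans (count≤count (point t) (λ (_ : Fin 1) → true) (λ _ _ → zero) (λ _ _ → _)
    (λ i j i≡t j≡t _ → toℕ-injective (trans (≡ᵇ⇒≡ (toℕ i) t i≡t) (sym (≡ᵇ⇒≡ (toℕ j) t j≡t)))))
    (≤-reflexive (count-all 1))

  segment-step : ∀ t i → T (segment (suc t) i) → T (segment t i ∨ point t i)
  segment-step t i s with Equivalence.to T-∨ s
  ... | inj₂ Gi = T-∨-introˡ (point t i) (T-∨-introʳ (toℕ i <ᵇ t) Gi)
  ... | inj₁ i<1+t with m<1+n⇒m<n∨m≡n (<ᵇ⇒< (toℕ i) (suc t) i<1+t)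
  ...   | inj₁ i<t = T-∨-introˡ (point t i) (T-∨-introˡ (G i) (<⇒<ᵇ i<t))
  ...   | inj₂ i≡t = T-∨-introʳ (segment t i) (≡⇒≡ᵇ (toℕ i) t i≡t)

  grow : ∀ t → size (suc t) ≤ suc (size t)
  grow t = begin
    size (suc t)                                 ≤⟨ count-mono (segment-step t) ⟩
    count (λ i → segment t i ∨ point t i)        ≤⟨ count-∨ (segment t) (point t) ⟩
    size t + count (point t)                     ≤⟨ +-monoʳ-≤ (size t) (at-most-one t) ⟩
    size t + 1                                   ≡⟨ +-comm (size t) 1 ⟩
    suc (size t)                                 ∎
    where open ≤-Reasoning

  threshold : ∃[ t ] size t ≡ k
  threshold = discrete-ivt size G≤k grow n (subst (k ≤_) (sym size-n) k≤n)

  t : ℕ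
  t = proj₁ threshold

  size-t≡k : count (segment t) ≡ k
  size-t≡k = proj₂ threshold

unique-⊆ : ∀ {A : Set} {xs ys : List A} → xs ⊆ ys → Unique ys → Unique xs
unique-⊆ []        []         = []
unique-⊆ (y ∷ʳ τ)  (_ ∷ u)    = unique-⊆ τ u
unique-⊆ (refl ∷ τ) (y∉ ∷ u)  = All-resp-⊆ τ y∉ ∷ unique-⊆ τ u

module Bipartite (a b : ℕ) where

  Vertex : Set
  Vertex = Fin a ⊎ Fin b

  -- side v = true iff v lies in X
  side : Vertex → Bool
  side (inj₁ _) = true
  side (inj₂ _) = false

  -- onSide c v: v lies on side c (a boolean, so that it can be counted)
  onSide : Bool → Vertex → Bool
  onSide true  = side
  onSide false = not ∘ side

  onSide-intro : ∀ {c v} → side v ≡ c → T (onSide c v)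
  onSide-intro {true}  {inj₁ _} _ = _
  onSide-intro {false} {inj₂ _} _ = _

  onSide-elim : ∀ c v → T (onSide c v) → side v ≡ c
  onSide-elim true  (inj₁ _) _ = refl
  onSide-elim false (inj₂ _) _ = refl

  onSide-not : ∀ c v → onSide (not c) v ≡ not (onSide c v)
  onSide-not true  v = refl
  onSide-not false v = sym (not-involutive (side v))

  side-clash : ∀ {c v} → side v ≡ c → side v ≢ not c
  side-clash refl = not-¬ refl

  partSize : Bool → ℕ
  partSize true  = a
  partSize false = b

  vertexOf : ∀ c → Fin (partSize c) → Vertex
  vertexOf true  = inj₁
  vertexOf false = inj₂

  vertexOf-side : ∀ c w → side (vertexOf c w) ≡ c
  vertexOf-side true  w = refl
  vertexOf-side false w = refl

  vertexOf-injective : ∀ c {w w′} → vertexOf c w ≡ vertexOf c w′ → w ≡ w′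
  vertexOf-injective true  = inj₁-injective
  vertexOf-injective false = inj₂-injective

  opposite-adjacent : ∀ {c u v} → side u ≡ not c → side v ≡ c → KBip-adj {a} {b} u v
  opposite-adjacent {true}  {inj₂ _} {inj₁ _} _ _ = _
  opposite-adjacent {false} {inj₁ _} {inj₂ _} _ _ = _

  adjacent-opposite : ∀ {u v} → KBip-adj {a} {b} u v → side u ≡ not (side v)
  adjacent-opposite {inj₁ _} {inj₂ _} _ = refl
  adjacent-opposite {inj₂ _} {inj₁ _} _ = refl

  go : Vertex → Vertex → Vertex
  go (inj₁ x) (inj₁ _) = inj₁ x
  go (inj₁ _) (inj₂ y) = inj₂ y
  go (inj₂ _) (inj₁ x) = inj₁ x
  go (inj₂ y) (inj₂ _) = inj₂ y

  go-legal : ∀ u t → go u t ≡ u ⊎ KBip-adj {a} {b} u (go u t)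
  go-legal (inj₁ _) (inj₁ _) = inj₁ refl
  go-legal (inj₁ _) (inj₂ _) = inj₂ _
  go-legal (inj₂ _) (inj₁ _) = inj₂ _
  go-legal (inj₂ _) (inj₂ _) = inj₁ refl

  go-reaches : ∀ u t → t ≡ u ⊎ KBip-adj {a} {b} u t → go u t ≡ t
  go-reaches (inj₁ x) (inj₁ _) (inj₁ refl) = refl
  go-reaches (inj₁ _) (inj₂ _) _           = refl
  go-reaches (inj₂ _) (inj₁ _) _           = refl
  go-reaches (inj₂ y) (inj₂ _) (inj₁ refl) = refl

  occupied : ∀ {n} → (Fin n → Vertex) → Vertex → Bool
  occupied P v = does (any? (λ j → ≡-dec _≟_ _≟_ (P j) v))

  occupied-witness : ∀ {n} (P : Fin n → Vertex) v → T (occupied P v) → ∃[ j ] P j ≡ v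
  occupied-witness P v o with any? (λ j → ≡-dec _≟_ _≟_ (P j) v)
  ... | yes found = found

  Unguarded : ∀ {n} → (Fin n → Vertex) → Vertex → Set
  Unguarded P v = ∀ j → P j ≢ v

  unoccupied : ∀ {n} (P : Fin n → Vertex) v → T (not (occupied P v)) → Unguarded P v
  unoccupied P v o j Pj≡v with any? (λ j → ≡-dec _≟_ _≟_ (P j) v)
  ... | no none = none (j , Pj≡v)

  tokensOn : ∀ {n} → (Fin n → Vertex) → Bool → ℕ
  tokensOn P c = count (λ i → onSide c (P i))

  on-both-sides : ∀ {n} (P : Fin n → Vertex) c → tokensOn P (not c) + tokensOn P c ≡ n
  on-both-sides {n} P c = begin
    tokensOn P (not c) + tokensOn P c                              ≡⟨ +-comm _ (tokensOn P c) ⟩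
    tokensOn P c + tokensOn P (not c)
      ≡⟨ cong (tokensOn P c +_) (count-ext (λ i → onSide-not c (P i))) ⟩
    count (λ i → onSide c (P i)) + count (λ i → not (onSide c (P i))) ≡⟨ count-complement (λ i → onSide c (P i)) ⟩
    n                                                              ∎
    where open ≡-Reasoning

module Play (a b r s : ℕ) where
  open Bipartite a b public
  open Game (KBip a b) 2 r s public

  Go : RevPos → RevPos → RevPos
  Go R D i = go (R i) (D i)

  Go-step : ∀ R D → Step R (Go R D)
  Go-step R D i = go-legal (R i) (D i)

  Go-reaches : ∀ {R D} → Step R D → ∀ i → Go R D i ≡ D i
  Go-reaches {R} {D} D-legal i = go-reaches (R i) (D i) (D-legal i)

  -- A scripted revolutionary strategy: start at R₀ and in round t+1 head for the t-th
  -- position of the script; stay put once the script is exhausted.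
  scriptTarget : List RevPos → List Config → RevPos → RevPos
  scriptTarget []       _       R = R
  scriptTarget (D ∷ _)  []      R = D
  scriptTarget (_ ∷ Ds) (_ ∷ h) R = scriptTarget Ds h R

  scripted : RevPos → List RevPos → RevStrategy
  scripted R₀ script = record
    { init = R₀
    ; move = λ h c → Go (proj₁ c) (scriptTarget script h (proj₁ c)) , Go-step _ _
    }

  Meets : RevPos → Vertex → Set
  Meets D v = Σ (Fin r) λ i → Σ (Fin r) λ j → i ≢ j × D i ≡ v × D j ≡ v

  meeting-guarded : ∀ {R S} → ¬ RevWinAt (R , S) → ∀ {v} → Meets R v → ∃[ k ] S k ≡ v
  meeting-guarded {R} {S} no-win {v} (i , j , i≢j , Ri≡v , Rj≡v) with any? (λ k → ≡-dec _≟_ _≟_ (S k) v)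
  ... | yes guard = guard
  ... | no  none  = ⊥-elim (no-win (v , (pair , pair-injective , pair-at-v) , λ k Sk≡v → none (k , Sk≡v)))
    where
    pair : Fin 2 → Fin r
    pair zero       = i
    pair (suc zero) = j
    pair-injective : Injective _≡_ _≡_ pair
    pair-injective {zero}     {zero}     _ = refl
    pair-injective {zero}     {suc zero} e = ⊥-elim (i≢j e)
    pair-injective {suc zero} {zero}     e = ⊥-elim (i≢j (sym e))
    pair-injective {suc zero} {suc zero} _ = refl
    pair-at-v : ∀ k → R (pair k) ≡ v
    pair-at-v zero       = Ri≡v
    pair-at-v (suc zero) = Rj≡v

  arrival-crossed : ∀ {S S′ : SpyPos} → Step S S′ → ∀ {k v} → S′ k ≡ v → Unguarded S v →
    side (S k) ≡ not (side v)
  arrival-crossed step {k} refl unguarded with step k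
  ... | inj₁ S′k≡Sk = ⊥-elim (unguarded k (sym S′k≡Sk))
  ... | inj₂ adj    = adjacent-opposite adj

  -- The revolutionaries on side c split into unguarded ones (possible partners for a
  -- meeting) and guarded ones.
  partners guarded : RevPos → SpyPos → Bool → ℕ
  partners R S c = count (λ i → onSide c (R i) ∧ not (occupied S (R i)))
  guarded  R S c = count (λ i → onSide c (R i) ∧ occupied S (R i))

  census : ∀ R S c → tokensOn R (not c) + partners R S c + guarded R S c ≡ r
  census R S c = begin
    tokensOn R (not c) + partners R S c + guarded R S c   ≡⟨ +-assoc (tokensOn R (not c)) _ _ ⟩
    tokensOn R (not c) + (partners R S c + guarded R S c) ≡⟨ cong (tokensOn R (not c) +_) split ⟩
    tokensOn R (not c) + tokensOn R c                      ≡⟨ on-both-sides R c ⟩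
    r                                                      ∎
    where
    open ≡-Reasoning
    split : partners R S c + guarded R S c ≡ tokensOn R c
    split = trans (+-comm (partners R S c) _) (count-split (λ i → onSide c (R i)) (λ i → occupied S (R i)))

  IsGuarded : RevPos → SpyPos → Bool → Fin r → Set
  IsGuarded R S c i = T (onSide c (R i) ∧ occupied S (R i))

  guarded-side : ∀ R S c i → IsGuarded R S c i → side (R i) ≡ c
  guarded-side R S c i g = onSide-elim c (R i) (proj₁ (Equivalence.to T-∧ g))

  guard-of : ∀ R S c i → IsGuarded R S c i → ∃[ k ] S k ≡ R i
  guard-of R S c i g = occupied-witness S (R i) (proj₂ (Equivalence.to T-∧ g))

  guards-distinct : ∀ {R S c} → Injective _≡_ _≡_ R → ∀ i j g g′ →
    proj₁ (guard-of R S c i g) ≡ proj₁ (guard-of R S c j g′) → i ≡ j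
  guards-distinct {R} {S} {c} R-injective i j g g′ e =
    R-injective (trans (sym (proj₂ (guard-of R S c i g))) (trans (cong S e) (proj₂ (guard-of R S c j g′))))

  send : RevPos → Fin r → Vertex → RevPos
  send D m v = updateAt D m (const v)

  -- The movers ms (on the other
  -- side) are sent, in order, first onto the vertices of the partners ps (unguarded
  -- revolutionaries on side c), then two at a time onto the free vertices fs of side c;
  -- a last mover without a companion stays put.
  module Plan (R : RevPos) (c : Bool) where

    plan : List (Fin r) → List (Fin r) → List Vertex → RevPos
    plan []            ps       fs       = R
    plan (m ∷ ms)      (p ∷ ps) fs       = send (plan ms ps fs) m (R p)
    plan (m ∷ [])      []       fs       = R
    plan (m ∷ m′ ∷ ms) []       []       = R
    plan (m ∷ m′ ∷ ms) []       (w ∷ fs) = send (send (plan ms [] fs) m w) m′ w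

    meetings : List (Fin r) → List (Fin r) → List Vertex → List Vertex
    meetings []            ps       fs       = []
    meetings (m ∷ ms)      (p ∷ ps) fs       = R p ∷ meetings ms ps fs
    meetings (m ∷ [])      []       fs       = []
    meetings (m ∷ m′ ∷ ms) []       []       = []
    meetings (m ∷ m′ ∷ ms) []       (w ∷ fs) = w ∷ meetings ms [] fs

    Movers : List (Fin r) → Set
    Movers = All (λ i → side (R i) ≡ not c)

    OnSide : List Vertex → Set
    OnSide = All (λ v → side v ≡ c)

    plan-idle : ∀ ms ps fs i → All (i ≢_) ms → plan ms ps fs i ≡ R i
    plan-idle []            ps       fs       i _                = refl
    plan-idle (m ∷ ms)      (p ∷ ps) fs       i (i≢m ∷ i∉ms)     =
      trans (updateAt-minimal i m _ i≢m) (plan-idle ms ps fs i i∉ms)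
    plan-idle (m ∷ [])      []       fs       i _                = refl
    plan-idle (m ∷ m′ ∷ ms) []       []       i _                = refl
    plan-idle (m ∷ m′ ∷ ms) []       (w ∷ fs) i (i≢m ∷ i≢m′ ∷ i∉ms) =
      trans (updateAt-minimal i m′ _ i≢m′) (trans (updateAt-minimal i m _ i≢m) (plan-idle ms [] fs i i∉ms))

    not-mover : ∀ {i} ms → side (R i) ≡ c → Movers ms → All (i ≢_) ms
    not-mover ms Ri-side = All.map (λ Rm-side i≡m → side-clash Ri-side (trans (cong (side ∘ R) i≡m) Rm-side))

    send-legal : ∀ {D m v} → Step R D → side (R m) ≡ not c → side v ≡ c → Step R (send D m v)
    send-legal {D} {m} {v} D-legal Rm-side v-side i with i ≟ m
    ... | yes refl = inj₂ (subst (KBip-adj (R i)) (sym (updateAt-updates i D)) (opposite-adjacent Rm-side v-side))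
    ... | no  i≢m  rewrite updateAt-minimal i m {const v} D i≢m = D-legal i

    plan-legal : ∀ ms ps fs → Movers ms → OnSide (map R ps) → OnSide fs → Step R (plan ms ps fs)
    plan-legal []            ps       fs       _              _          _          i = inj₁ refl
    plan-legal (m ∷ ms)      (p ∷ ps) fs       (Rm ∷ movers)  (Rp ∷ sps) sfs        =
      send-legal (plan-legal ms ps fs movers sps sfs) Rm Rp
    plan-legal (m ∷ [])      []       fs       _              _          _          i = inj₁ refl
    plan-legal (m ∷ m′ ∷ ms) []       []       _              _          _          i = inj₁ refl
    plan-legal (m ∷ m′ ∷ ms) []       (w ∷ fs) (Rm ∷ Rm′ ∷ movers) sps   (sw ∷ sfs) =
      send-legal (send-legal (plan-legal ms [] fs movers sps sfs) Rm sw) Rm′ sw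

    send-keeps-meeting : ∀ {D m w v} → D m ≡ R m → side (R m) ≡ not c →
      side v ≡ c × Meets D v → side v ≡ c × Meets (send D m w) v
    send-keeps-meeting {D} {m} {w} {v} Dm≡Rm Rm-side (v-side , i , j , i≢j , Di≡v , Dj≡v) =
      v-side , i , j , i≢j , keep i Di≡v , keep j Dj≡v
      where
      keep : ∀ k → D k ≡ v → send D m w k ≡ v
      keep k Dk≡v = trans (updateAt-minimal k m D k≢m) Dk≡v
        where
        k≢m : k ≢ m
        k≢m refl = side-clash v-side (trans (cong side (trans (sym Dk≡v) Dm≡Rm)) Rm-side)

    plan-meets : ∀ ms ps fs → Unique ms → Movers ms → OnSide (map R ps) → OnSide fs →
      All (λ v → side v ≡ c × Meets (plan ms ps fs) v) (meetings ms ps fs)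
    plan-meets []            ps       fs       _ _ _ _ = []
    plan-meets (m ∷ ms)      (p ∷ ps) fs       (m∉ms ∷ u) (Rm ∷ movers) (Rp ∷ sps) sfs =
      (Rp , m , p , m≢p , updateAt-updates m D , Dp≡Rp)
      ∷ All.map (send-keeps-meeting (plan-idle ms ps fs m m∉ms) Rm) (plan-meets ms ps fs u movers sps sfs)
      where
      D : RevPos
      D = plan ms ps fs
      m≢p : m ≢ p
      m≢p refl = side-clash Rp Rm
      Dp≡Rp : send D m (R p) p ≡ R p
      Dp≡Rp = trans (updateAt-minimal p m D (m≢p ∘ sym)) (plan-idle ms ps fs p (not-mover ms Rp movers))
    plan-meets (m ∷ [])      []       fs       _ _ _ _ = []
    plan-meets (m ∷ m′ ∷ ms) []       []       _ _ _ _ = []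
    plan-meets (m ∷ m′ ∷ ms) []       (w ∷ fs)
               ((m≢m′ ∷ m∉ms) ∷ m′∉ms ∷ u) (Rm ∷ Rm′ ∷ movers) sps (sw ∷ sfs) =
      (sw , m , m′ , m≢m′ , trans (updateAt-minimal m m′ D₁ m≢m′) (updateAt-updates m D) , updateAt-updates m′ D₁)
      ∷ All.map (send-keeps-meeting D₁m′≡Rm′ Rm′ ∘ send-keeps-meeting Dm≡Rm Rm)
                (plan-meets ms [] fs u movers sps sfs)
      where
      D D₁ : RevPos
      D = plan ms [] fs
      D₁ = send D m w
      Dm≡Rm : D m ≡ R m
      Dm≡Rm = plan-idle ms [] fs m m∉ms
      D₁m′≡Rm′ : D₁ m′ ≡ R m′
      D₁m′≡Rm′ = trans (updateAt-minimal m′ m D (m≢m′ ∘ sym)) (plan-idle ms [] fs m′ m′∉ms)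

    meetings-⊆ : ∀ ms ps fs → meetings ms ps fs ⊆ map R ps ++ fs
    meetings-⊆ []            ps       fs       = minimum _
    meetings-⊆ (m ∷ ms)      (p ∷ ps) fs       = refl ∷ meetings-⊆ ms ps fs
    meetings-⊆ (m ∷ [])      []       fs       = minimum _
    meetings-⊆ (m ∷ m′ ∷ ms) []       []       = []
    meetings-⊆ (m ∷ m′ ∷ ms) []       (w ∷ fs) = refl ∷ meetings-⊆ ms [] fs

    meetings-threat : ∀ ms ps fs → length ms ≤ length fs →
      Threat (length ms) (length ps) (length (meetings ms ps fs))
    meetings-threat []            ps       fs       _          = inj₁ z≤n
    meetings-threat (m ∷ ms)      (p ∷ ps) fs       room       =
      threat-pair (meetings-threat ms ps fs (≤-trans (n≤1+n _) room))
    meetings-threat (m ∷ [])      []       fs       _          = inj₂ ≤-refl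
    meetings-threat (m ∷ m′ ∷ ms) []       []       ()
    meetings-threat (m ∷ m′ ∷ ms) []       (w ∷ fs) (s≤s room) =
      threat-walkers (meetings-threat ms [] fs (≤-trans (n≤1+n _) room))


  -- Distinct occupied vertices of side c have distinct occupants, which stand on side c; so
  -- there are at most as many of them as tokens satisfying any Q that holds on side c.
  occupied-on-side : ∀ {n} (P : Fin n → Vertex) (Q : Fin n → Bool) c → (∀ j → side (P j) ≡ c → T (Q j)) →
    count (λ w → occupied P (vertexOf c w)) ≤ count Q
  occupied-on-side P Q c on-side = count≤count _ Q occupant occupant-in-Q occupant-injective
    where
    occupant : ∀ w → T (occupied P (vertexOf c w)) → Fin _
    occupant w o = proj₁ (occupied-witness P _ o)
    occupant-in-Q : ∀ w o → T (Q (occupant w o))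
    occupant-in-Q w o = on-side _ (trans (cong side (proj₂ (occupied-witness P _ o))) (vertexOf-side c w))
    occupant-injective : ∀ w w′ o o′ → occupant w o ≡ occupant w′ o′ → w ≡ w′
    occupant-injective w w′ o o′ e = vertexOf-injective c
      (trans (sym (proj₂ (occupied-witness P _ o))) (trans (cong P e) (proj₂ (occupied-witness P _ o′))))

  free : RevPos → SpyPos → (c : Bool) → Fin (partSize c) → Bool
  free R S c w = not (occupied S (vertexOf c w) ∨ occupied R (vertexOf c w))

  free-unguarded : ∀ R S c w → T (free R S c w) → Unguarded S (vertexOf c w) × Unguarded R (vertexOf c w)
  free-unguarded R S c w f with occupied S (vertexOf c w) in eqS | occupied R (vertexOf c w) in eqR
  ... | false | false = unoccupied S _ (subst (T ∘ not) (sym eqS) _) , unoccupied R _ (subst (T ∘ not) (sym eqR) _)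

  enough-free : ∀ R S c → 2 * r ≤ partSize c → s ≤ r → tokensOn R (not c) ≤ count (free R S c)
  enough-free R S c room s≤r = +-cancelʳ-≤ (count taken) _ _ (begin
    tokensOn R (not c) + count taken          ≤⟨ +-monoʳ-≤ (tokensOn R (not c)) taken≤ ⟩
    tokensOn R (not c) + (s + tokensOn R c)   ≡⟨ x∙yz≈y∙xz (tokensOn R (not c)) s _ ⟩
    s + (tokensOn R (not c) + tokensOn R c)   ≡⟨ cong (s +_) (on-both-sides R c) ⟩
    s + r                                     ≤⟨ +-monoˡ-≤ r s≤r ⟩
    r + r                                     ≡⟨ cong (r +_) (+-identityʳ r) ⟨
    2 * r                                     ≤⟨ room ⟩
    partSize c                                ≡⟨ count-complement taken ⟨
    count taken + count (free R S c)          ≡⟨ +-comm (count taken) _ ⟩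
    count (free R S c) + count taken          ∎)
    where
    open ≤-Reasoning
    taken : Fin (partSize c) → Bool
    taken w = occupied S (vertexOf c w) ∨ occupied R (vertexOf c w)
    taken≤ : count taken ≤ s + tokensOn R c
    taken≤ = ≤-trans (count-∨ (λ w → occupied S (vertexOf c w)) (λ w → occupied R (vertexOf c w))) (+-mono-≤
      (≤-trans (occupied-on-side S (λ _ → true) c (λ _ _ → _)) (≤-reflexive (count-all s)))
      (occupied-on-side R (λ i → onSide c (R i)) c (λ _ → onSide-intro)))

  -- After the spy move S₀ → S₁, each revolutionary on side c that was unguarded before but is
  -- guarded now has its own guard, which crossed from the other side into side c.
  guard-bound : ∀ {S₀ S₁ : SpyPos} R c → Step S₀ S₁ → Injective _≡_ _≡_ R → (∀ i → Unguarded S₀ (R i)) →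
    guarded R S₁ c ≤ count (λ k → onSide (not c) (S₀ k) ∧ onSide c (S₁ k))
  guard-bound {S₀} {S₁} R c step R-injective unguarded =
    count≤count _ _ (λ i g → proj₁ (guard-of R S₁ c i g)) crossed (guards-distinct {c = c} R-injective)
    where
    crossed : ∀ i g → let k = proj₁ (guard-of R S₁ c i g) in T (onSide (not c) (S₀ k) ∧ onSide c (S₁ k))
    crossed i g = Equivalence.from T-∧
      ( onSide-intro (trans (arrival-crossed step (proj₂ (guard-of R S₁ c i g)) (unguarded i))
                            (cong not (guarded-side R S₁ c i g)))
      , onSide-intro (trans (cong side (proj₂ (guard-of R S₁ c i g))) (guarded-side R S₁ c i g)))

  guards-on-side : ∀ R S c → Injective _≡_ _≡_ R → guarded R S c ≤ tokensOn S c
  guards-on-side R S c R-injective =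
    count≤count _ _ (λ i g → proj₁ (guard-of R S c i g)) guard-side (guards-distinct {c = c} R-injective)
    where
    guard-side : ∀ i g → T (onSide c (S (proj₁ (guard-of R S c i g))))
    guard-side i g = onSide-intro (trans (cong side (proj₂ (guard-of R S c i g))) (guarded-side R S c i g))

  module AtPosition (σ : SpyStrategy) (h : List Config) (R : RevPos) (S : SpyPos)
    (survives : ∀ D → ¬ RevWinAt (Go R D , proj₁ (SpyStrategy.move σ h (R , S) (Go R D)))) where

    reply : RevPos → SpyPos
    reply D = proj₁ (SpyStrategy.move σ h (R , S) (Go R D))

    -- Distinct unguarded meeting points on side c, staged by a legal move D, need distinct
    -- guards, and each guard must arrive from the other side.
    spies-needed : ∀ c D → Step R D → ∀ vs → Unique vs →
      All (λ v → (side v ≡ c × Meets D v) × Unguarded S v) vs → length vs ≤ tokensOn S (not c)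
    spies-needed c D D-legal vs vs-unique meets =
      length≤count _ _ guard arrives-across guard-injective vs vs-unique meets
      where
      meeting-guard : ∀ v → (side v ≡ c × Meets D v) × Unguarded S v → ∃[ k ] reply D k ≡ v
      meeting-guard v ((_ , i , j , i≢j , Di≡v , Dj≡v) , _) = meeting-guarded (survives D)
        (i , j , i≢j , trans (Go-reaches D-legal i) Di≡v , trans (Go-reaches D-legal j) Dj≡v)
      guard : ∀ v → (side v ≡ c × Meets D v) × Unguarded S v → Fin s
      guard v q = proj₁ (meeting-guard v q)
      arrives-across : ∀ v q → T (onSide (not c) (S (guard v q)))
      arrives-across v q@((v-side , _) , v-unguarded) = onSide-intro (trans
        (arrival-crossed (proj₂ (SpyStrategy.move σ h (R , S) (Go R D))) (proj₂ (meeting-guard v q)) v-unguarded)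
        (cong not v-side))
      guard-injective : ∀ v w q q′ → guard v q ≡ guard w q′ → v ≡ w
      guard-injective v w q q′ e =
        trans (sym (proj₂ (meeting-guard v q))) (trans (cong (reply D) e) (proj₂ (meeting-guard w q′)))

    threat-at : ∀ c → 2 * r ≤ partSize c → s ≤ r → Injective _≡_ _≡_ R →
      Threat (tokensOn R (not c)) (partners R S c) (tokensOn S (not c))
    threat-at c room s≤r R-injective = threat-mono
      (subst₂ (λ x y → Threat x y (length (meetings ms ps fs))) (members-length moving) (members-length standing)
        (meetings-threat ms ps fs enough-room))
      (spies-needed c (plan ms ps fs) (plan-legal ms ps fs movers-side partners-side free-side)
        (meetings ms ps fs) (unique-⊆ (meetings-⊆ ms ps fs) candidates-unique)
        (All.zip (plan-meets ms ps fs (members-unique moving) movers-side partners-side free-side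
                 , All-resp-⊆ (meetings-⊆ ms ps fs) candidates-unguarded)))
      where
      open Plan R c
      moving standing : Fin r → Bool
      moving   i = onSide (not c) (R i)
      standing i = onSide c (R i) ∧ not (occupied S (R i))

      ms ps : List (Fin r)
      ms = members moving
      ps = members standing
      fs : List Vertex
      fs = map (vertexOf c) (members (free R S c))

      movers-side : Movers ms
      movers-side = All.map (onSide-elim (not c) _) (members-sound moving)
      partners-side : OnSide (map R ps)
      partners-side = AllP.map⁺ (All.map (onSide-elim c _ ∘ proj₁ ∘ Equivalence.to T-∧) (members-sound standing))
      free-side : OnSide fs
      free-side = AllP.map⁺ (All.universal (vertexOf-side c) _)

      free-empty : All (λ v → Unguarded S v × Unguarded R v) fs
      free-empty = AllP.map⁺ (All.map (free-unguarded R S c _) (members-sound (free R S c)))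

      candidates-unguarded : All (Unguarded S) (map R ps ++ fs)
      candidates-unguarded = AllP.++⁺
        (AllP.map⁺ (All.map (λ p → unoccupied S _ (proj₂ (Equivalence.to T-∧ p))) (members-sound standing)))
        (All.map proj₁ free-empty)

      candidates-unique : Unique (map R ps ++ fs)
      candidates-unique = UniqueP.++⁺
        (UniqueP.map⁺ R-injective (members-unique standing))
        (UniqueP.map⁺ (vertexOf-injective c) (members-unique (free R S c)))
        λ (v∈Rps , v∈fs) → let (p , _ , v≡Rp) = ∈-map⁻ R v∈Rps in
          proj₂ (All.lookup free-empty v∈fs) p (sym v≡Rp)

      enough-room : length ms ≤ length fs
      enough-room = subst₂ _≤_ (sym (members-length moving))
        (sym (trans (length-map (vertexOf c) (members (free R S c))) (members-length (free R S c))))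
        (enough-free R S c room s≤r)

  crossers : SpyPos → SpyPos → Bool → Bool → ℕ
  crossers S₀ S₁ p q = count (λ k → onSide p (S₀ k) ∧ onSide q (S₁ k))

  departures : ∀ S₀ S₁ p → crossers S₀ S₁ p true + crossers S₀ S₁ p false ≡ tokensOn S₀ p
  departures S₀ S₁ p = count-split (λ k → onSide p (S₀ k)) (λ k → side (S₁ k))

  arrivals : ∀ S₀ S₁ q → crossers S₀ S₁ true q + crossers S₀ S₁ false q ≡ tokensOn S₁ q
  arrivals S₀ S₁ q = trans
    (cong₂ _+_ (count-ext (λ k → ∧-comm (side (S₀ k)) _)) (count-ext (λ k → ∧-comm (not (side (S₀ k))) _)))
    (count-split (λ k → onSide q (S₁ k)) (λ k → side (S₀ k)))

module TwoRounds (a b r s : ℕ) (2r≤a : 2 * r ≤ a) (2r≤b : 2 * r ≤ b) (s≤r : s ≤ r)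
  (σ : Play.SpyStrategy a b r s)
  (σ-wins : ∀ ρ n → ¬ Play.RevWinAt a b r s (proj₂ (Play.play a b r s ρ σ n))) where

  open Play a b r s

  ι : Fin r → Fin a
  ι i = inject≤ i (≤-trans (m≤m+n r (r + 0)) 2r≤a)

  R₀ : RevPos
  R₀ i = inj₁ (ι i)

  R₀-injective : Injective _≡_ _≡_ R₀
  R₀-injective = inject≤-injective _ _ _ _ ∘ inj₁-injective

  S₀ : SpyPos
  S₀ = SpyStrategy.init σ R₀

  survives₀ : ∀ D → ¬ RevWinAt (Go R₀ D , proj₁ (SpyStrategy.move σ [] (R₀ , S₀) (Go R₀ D)))
  survives₀ D = σ-wins (scripted R₀ (D ∷ [])) 1

  module Round₀ = AtPosition σ [] R₀ S₀ survives₀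

  x₀ : ℕ
  x₀ = tokensOn S₀ true

  -- Threat in round 1: all r revolutionaries could walk to Y.
  threat₁ : Threat r (partners R₀ S₀ false) x₀
  threat₁ = subst (λ m → Threat m (partners R₀ S₀ false) x₀) (count-all r)
    (Round₀.threat-at false 2r≤b s≤r R₀-injective)

  fy : Fin r → Fin b
  fy i = enumerate (free R₀ S₀ false) (inject≤ i r≤free)
    where
    r≤free : r ≤ count (free R₀ S₀ false)
    r≤free = subst (_≤ count (free R₀ S₀ false)) (count-all r) (enough-free R₀ S₀ false 2r≤b s≤r)

  fy-injective : ∀ {i j} → fy i ≡ fy j → i ≡ j
  fy-injective = inject≤-injective _ _ _ _ ∘ enumerate-injective (free R₀ S₀ false) _ _

  fy-unguarded : ∀ i → Unguarded S₀ (inj₂ (fy i))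
  fy-unguarded i = proj₁ (free-unguarded R₀ S₀ false _ (enumerate-sound (free R₀ S₀ false) _))

  guarded₀ : Fin r → Bool
  guarded₀ i = occupied S₀ (R₀ i)

  crossing : Σ (Fin r → Bool) λ K → (∀ i → T (guarded₀ i) → T (K i)) × count K ≡ x₀
  crossing = enlarge guarded₀ x₀ (guards-on-side R₀ S₀ true R₀-injective) x₀≤r
    where
    x₀≤r : x₀ ≤ r
    x₀≤r = ≤-trans (count-mono {P = λ k → onSide true (S₀ k)} {Q = λ _ → true} (λ _ _ → _))
                   (subst (_≤ r) (sym (count-all s)) s≤r)

  K : Fin r → Bool
  K = proj₁ crossing

  D₁ : RevPos
  D₁ i = if K i then inj₂ (fy i) else R₀ i

  D₁-legal : Step R₀ D₁
  D₁-legal i with K i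
  ... | true  = inj₂ _
  ... | false = inj₁ refl

  D₁-injective : ∀ {i j} → D₁ i ≡ D₁ j → i ≡ j
  D₁-injective {i} {j} e with K i | K j
  ... | true  | true  = fy-injective (inj₂-injective e)
  ... | false | false = R₀-injective e

  D₁-unguarded : ∀ i → Unguarded S₀ (D₁ i)
  D₁-unguarded i with K i in Ki
  ... | true  = fy-unguarded i
  ... | false = unoccupied S₀ (R₀ i) (contrapositive (proj₁ (proj₂ crossing) i) Ki)
    where
    contrapositive : ∀ {x y} → (T x → T y) → y ≡ false → T (not x)
    contrapositive {false} _   _  = _
    contrapositive {true}  x⇒y refl = x⇒y _

  D₁-in-Y : tokensOn D₁ false ≡ x₀
  D₁-in-Y = trans (count-ext in-Y) (proj₂ (proj₂ crossing))
    where
    in-Y : ∀ i → onSide false (D₁ i) ≡ K i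
    in-Y i with K i
    ... | true  = refl
    ... | false = refl

  R₁ : RevPos
  R₁ = Go R₀ D₁

  S₁ : SpyPos
  S₁ = proj₁ (SpyStrategy.move σ [] (R₀ , S₀) R₁)

  survives₁ : ∀ D → ¬ RevWinAt (Go R₁ D , proj₁ (SpyStrategy.move σ ((R₀ , S₀) ∷ []) (R₁ , S₁) (Go R₁ D)))
  survives₁ D = σ-wins (scripted R₀ (D₁ ∷ D ∷ [])) 2

  module Round₁ = AtPosition σ ((R₀ , S₀) ∷ []) R₁ S₁ survives₁

  R₁-is-D₁ : ∀ i → R₁ i ≡ D₁ i
  R₁-is-D₁ = Go-reaches D₁-legal

  R₁-injective : Injective _≡_ _≡_ R₁
  R₁-injective {i} {j} e = D₁-injective (trans (sym (R₁-is-D₁ i)) (trans e (R₁-is-D₁ j)))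

  R₁-unguarded : ∀ i → Unguarded S₀ (R₁ i)
  R₁-unguarded i = subst (Unguarded S₀) (sym (R₁-is-D₁ i)) (D₁-unguarded i)

  R₁-in-Y : tokensOn R₁ false ≡ x₀
  R₁-in-Y = trans (count-ext (λ i → cong (onSide false) (R₁-is-D₁ i))) D₁-in-Y

  spy-step₁ : Step S₀ S₁
  spy-step₁ = proj₂ (SpyStrategy.move σ [] (R₀ , S₀) R₁)

  A B C E : ℕ
  A = crossers S₀ S₁ true  true
  B = crossers S₀ S₁ true  false
  C = crossers S₀ S₁ false true
  E = crossers S₀ S₁ false false

  all-spies : s ≡ A + B + C + E
  all-spies = begin
    s                        ≡⟨ on-both-sides S₀ true ⟨
    tokensOn S₀ false + x₀   ≡⟨ cong₂ _+_ (departures S₀ S₁ false) (departures S₀ S₁ true) ⟨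
    (C + E) + (A + B)        ≡⟨ +-comm (C + E) (A + B) ⟩
    (A + B) + (C + E)        ≡⟨ +-assoc (A + B) C E ⟨
    A + B + C + E            ∎
    where open ≡-Reasoning

  seven-r≤ten-s : 7 * r ≤ 10 * s + 7
  seven-r≤ten-s = subst (λ n → 7 * r ≤ 10 * n + 7) (sym all-spies) (seven-r-bound
    (subst (Threat r _) (sym (departures S₀ S₁ true)) threat₁)
    (trans R₁-in-Y (sym (departures S₀ S₁ true)))
    (on-both-sides R₁ true)
    (subst (Threat _ _) (sym (arrivals S₀ S₁ false)) (Round₁.threat-at true 2r≤a s≤r R₁-injective))
    (census R₁ S₁ true)
    (guard-bound R₁ true spy-step₁ R₁-injective R₁-unguarded)
    (subst (Threat _ _) (sym (arrivals S₀ S₁ true)) (Round₁.threat-at false 2r≤b s≤r R₁-injective))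
    (census R₁ S₁ false)
    (guard-bound R₁ false spy-step₁ R₁-injective R₁-unguarded))

spies-needed-on-KBip : ∀ a b r s → 2 * r ≤ a → 2 * r ≤ b → SpiesWinRS (KBip a b) 2 r s → 7 * r ≤ 10 * s + 7
spies-needed-on-KBip a b r s 2r≤a 2r≤b (σ , σ-wins) with s ≤? r
... | yes s≤r = TwoRounds.seven-r≤ten-s a b r s 2r≤a 2r≤b s≤r σ σ-wins
... | no  s≰r = begin
  7 * r            ≤⟨ *-monoʳ-≤ 7 (<⇒≤ (≰⇒> s≰r)) ⟩
  7 * s            ≤⟨ *-monoˡ-≤ s (m≤m+n 7 3) ⟩
  10 * s           ≤⟨ m≤m+n (10 * s) 7 ⟩
  10 * s + 7       ∎
  where open ≤-Reasoning

theorem7p2 : (r a b : ℕ) → 2 ≤ r → 2 * r ≤ a → 2 * r ≤ b →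
    σ≥ (KBip a b) 2 r ⌈ ((7 * r) / 2 ∸ 3) / 5 ⌉
theorem7p2 r a b _ 2r≤a 2r≤b s s<bound spies-win =
  <⇒≱ (below-bound r s s<bound) (spies-needed-on-KBip a b r s 2r≤a 2r≤b spies-win)
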